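{- Let $A=\begin{pmatrix} a & b \\ c & 0 \end{pmatrix}\in M_2(\mathbb{Z})$ with $bc\neq 0$ and $\gcd(a,b,c)=1$, let $K=\mathbb{Q}(\sqrt{a^2+4bc})$ with ring of integers $\mathcal{O}_K$, let $u,v,w$ be nonzero integers with $\gcd(u,v,w)=1$, and let $i,j,k$ be positive integers. If there exist $X,Y,Z\in C(A)$ with $\det(XYZ)\neq 0$ and $uX^i+vY^j=wZ^k$, then there exist $x,y,z\in\mathcal{O}_K$ with $xyz\neq 0$ and $ux^i+vy^j=wz^k$.
   Context: $C(A)=\{B\in M_2(\mathbb{Z}): AB=BA\}$. If $a^2+4bc$ is a square, $K=\mathbb{Q}$ and $\mathcal{O}_K=\mathbb{Z}$. -}

module Defs where

open import Data.Nat using (ℕ; zero; suc)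
open import Data.Integer as ℤ using (ℤ)
open import Data.Rational as ℚ using (ℚ)
open import Data.List using (List; []; _∷_)
open import Data.Product using (Σ; ∃; _×_; _,_)
open import Relation.Binary.PropositionalEquality using (_≡_)

record M2 : Set where
  constructor mat
  field
    m11 m12 m21 m22 : ℤ
open M2 public

infixl 7 _⊛_
infixl 6 _⊕_
infixr 8 _^ᴹ_
infixr 7 _·_

_⊛_ : M2 → M2 → M2
mat a b c d ⊛ mat e f g h =
  mat (a ℤ.* e ℤ.+ b ℤ.* g) (a ℤ.* f ℤ.+ b ℤ.* h)
      (c ℤ.* e ℤ.+ d ℤ.* g) (c ℤ.* f ℤ.+ d ℤ.* h)

_⊕_ : M2 → M2 → M2
mat a b c d ⊕ mat e f g h = mat (a ℤ.+ e) (b ℤ.+ f) (c ℤ.+ g) (d ℤ.+ h)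

_·_ : ℤ → M2 → M2
s · mat a b c d = mat (s ℤ.* a) (s ℤ.* b) (s ℤ.* c) (s ℤ.* d)

I2 : M2
I2 = mat ℤ.1ℤ ℤ.0ℤ ℤ.0ℤ ℤ.1ℤ

_^ᴹ_ : M2 → ℕ → M2
X ^ᴹ zero = I2
X ^ᴹ suc n = X ⊛ (X ^ᴹ n)

det : M2 → ℤ
det (mat a b c d) = a ℤ.* d ℤ.- b ℤ.* c

Amat : ℤ → ℤ → ℤ → M2
Amat a b c = mat a b c ℤ.0ℤ

InC : M2 → M2 → Set
InC A B = A ⊛ B ≡ B ⊛ A

disc : ℤ → ℤ → ℤ → ℤ
disc a b c = a ℤ.* a ℤ.+ (ℤ.+ 4) ℤ.* (b ℤ.* c)

IsSquare : ℤ → Set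
IsSquare D = Σ ℤ λ m → m ℤ.* m ≡ D

-- The quadratic field K = ℚ(√D) for D a non-square integer,
-- elements written p + q√D with p q ∈ ℚ.

record K (D : ℤ) : Set where
  constructor _+√·_
  field
    re im : ℚ
open K public

module _ {D : ℤ} where
  infixl 7 _*ᴷ_
  infixl 6 _+ᴷ_
  infixr 8 _^ᴷ_

  Dℚ : ℚ
  Dℚ = D ℚ./ 1

  _+ᴷ_ : K D → K D → K D
  (p +√· q) +ᴷ (r +√· s) = (p ℚ.+ r) +√· (q ℚ.+ s)

  _*ᴷ_ : K D → K D → K D
  (p +√· q) *ᴷ (r +√· s) = (p ℚ.* r ℚ.+ Dℚ ℚ.* (q ℚ.* s)) +√· (p ℚ.* s ℚ.+ q ℚ.* r)

  0ᴷ : K D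
  0ᴷ = ℚ.0ℚ +√· ℚ.0ℚ

  1ᴷ : K D
  1ᴷ = ℚ.1ℚ +√· ℚ.0ℚ

  ιᴷ : ℤ → K D
  ιᴷ n = (n ℚ./ 1) +√· ℚ.0ℚ

  _^ᴷ_ : K D → ℕ → K D
  x ^ᴷ zero = 1ᴷ
  x ^ᴷ suc n = x *ᴷ (x ^ᴷ n)

  -- value at x of the monic polynomial  c₀ + c₁ t + … + c_{n-1} t^{n-1} + t^n
  -- where the list is [c₀, …, c_{n-1}]
  evalMonic : List ℤ → K D → K D
  evalMonic [] x = 1ᴷ
  evalMonic (c ∷ cs) x = ιᴷ c +ᴷ (x *ᴷ evalMonic cs x)

  InOK : K D → Set
  InOK x = Σ (List ℤ) λ cs → evalMonic cs x ≡ 0ᴷ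

-- Solvability of u x^i + v y^j = w z^k in 𝒪_K with xyz ≠ 0.
-- If D is a square, K = ℚ and 𝒪_K = ℤ; otherwise K = ℚ(√D) as above.

SolvableInℤ : ℤ → ℤ → ℤ → ℕ → ℕ → ℕ → Set
SolvableInℤ u v w i j k =
  Σ ℤ λ x → Σ ℤ λ y → Σ ℤ λ z →
    (x ℤ.* y ℤ.* z ≡ ℤ.0ℤ → Data.Empty.⊥) ×
    (u ℤ.* (x ℤ.^ i) ℤ.+ v ℤ.* (y ℤ.^ j) ≡ w ℤ.* (z ℤ.^ k))
  where import Data.Empty

SolvableInK : (D : ℤ) → ℤ → ℤ → ℤ → ℕ → ℕ → ℕ → Set
SolvableInK D u v w i j k =
  Σ (K D) λ x → Σ (K D) λ y → Σ (K D) λ z →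
    InOK x × InOK y × InOK z ×
    (x *ᴷ y *ᴷ z ≡ 0ᴷ → Data.Empty.⊥) ×
    (ιᴷ u *ᴷ (x ^ᴷ i) +ᴷ ιᴷ v *ᴷ (y ^ᴷ j) ≡ ιᴷ w *ᴷ (z ^ᴷ k))
  where import Data.Empty

SolvableInOK : ℤ → ℤ → ℤ → ℤ → ℕ → ℕ → ℕ → Set
SolvableInOK D u v w i j k =
  (IsSquare D × SolvableInℤ u v w i j k) ⊎
  ((IsSquare D → ⊥) × SolvableInK D u v w i j k)
  where
  open import Data.Sum using (_⊎_)
  open import Data.Empty using (⊥)

{-# OPTIONS --safe #-}
-- Since gcd (a, b, c) = 1, a matrix commuting with A is x I + y A for integers x, y (y comes
-- from a Bézout relation α a + β b + γ c = 1), and A² = a A + bc I.  So C(A) is the ring ℤ[θ] with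
-- θ² = a θ + bc, and det (x I + y A) is the norm x² + a x y - bc y².  Sending θ to a root of
-- t² - a t - bc, namely the integer (a + m) / 2 if a² + 4bc = m² and (a + √D) / 2 ∈ K otherwise,
-- is a ring homomorphism that kills no element of nonzero norm, and its values are algebraic
-- integers (roots of t² - T t + N with T and N the integral trace and norm).  Its values at the
-- matrices X, Y, Z solve the equation in 𝒪_K.
module Submission where

open import Defs
open import Data.Nat using (ℕ; _≤_)
open import Data.Integer using (ℤ; _*_; 0ℤ; 1ℤ)
open import Data.Integer.GCD using (gcd)
open import Data.Product using (Σ; _×_)
open import Relation.Binary.PropositionalEquality using (_≡_; _≢_)

open import Data.Nat as ℕ using (zero; suc; z≤n; s≤s)
import Data.Nat.Properties as ℕ
import Data.Nat.GCD as ℕ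
import Data.Nat.Divisibility as ℕ
open import Data.Nat.Coprimality as Coprimality using ()
open import Data.Integer as ℤ using (+_; -[1+_]; +[1+_]; _+_; _-_; -_; ∣_∣)
import Data.Integer.Properties as ℤ
import Data.Integer.DivMod as ℤ
import Data.Integer.Divisibility.Signed as ℤ
open import Data.Integer.Tactic.RingSolver using (solve)
open import Data.Rational as ℚ using (ℚ; mkℚ; ½; 0ℚ; 1ℚ)
import Data.Rational.Properties as ℚ
open import Data.Product using (∃-syntax; _,_)
open import Data.Sum using (_⊎_; inj₁; inj₂)
open import Data.Empty using (⊥-elim)
open import Data.List using ([]; _∷_)
open import Level using (0ℓ)
open import Relation.Nullary using (Dec; yes; no; contradiction)
open import Relation.Nullary.Decidable using (map′; dec⇒maybe)
open import Relation.Binary.PropositionalEquality using (refl; sym; trans; cong; cong₂; subst; module ≡-Reasoning)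
import Tactic.RingSolver as RingSolver
open import Tactic.RingSolver.Core.AlmostCommutativeRing using (AlmostCommutativeRing; fromCommutativeRing)

open ≡-Reasoning

private
  sign-multiplier : ∀ i → ∃[ σ ] + ∣ i ∣ ≡ σ * i
  sign-multiplier (+ n)    = 1ℤ , sym (ℤ.*-identityˡ (+ n))
  sign-multiplier -[1+ n ] = ℤ.-1ℤ , sym (ℤ.-1*i≡-i -[1+ n ])

  pos-identity : ∀ {d m n} x y → d ℕ.+ y ℕ.* n ≡ x ℕ.* m → + d + + y * + n ≡ + x * + m
  pos-identity {d} {m} {n} x y eq = begin
    + d + + y * + n     ≡⟨ cong (λ t → + d + t) (ℤ.pos-* y n) ⟨
    + d + + (y ℕ.* n)   ≡⟨ ℤ.pos-+ d (y ℕ.* n) ⟨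
    + (d ℕ.+ y ℕ.* n)   ≡⟨ cong +_ eq ⟩
    + (x ℕ.* m)         ≡⟨ ℤ.pos-* x m ⟩
    + x * + m           ∎

  identity⇒combination : ∀ {d m n} x y {σ τ} i j → d + y * n ≡ x * m → m ≡ σ * i → n ≡ τ * j →
                         x * σ * i + - (y * τ) * j ≡ d
  identity⇒combination {d} x y {σ} {τ} i j eq refl refl = begin
    x * σ * i + - (y * τ) * j      ≡⟨ solve (x ∷ y ∷ σ ∷ τ ∷ i ∷ j ∷ []) ⟩
    x * (σ * i) - y * (τ * j)      ≡⟨ cong (_- y * (τ * j)) eq ⟨
    d + y * (τ * j) - y * (τ * j)  ≡⟨ solve (d ∷ y ∷ τ ∷ j ∷ []) ⟩
    d                              ∎

-- The library's Bézout identity for ∣ i ∣ and ∣ j ∣ comes in two sign patterns; multiplying by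
-- the signs of i and j turns either one into α i + β j = gcd i j.
bézout : ∀ i j → ∃[ α ] ∃[ β ] α * i + β * j ≡ gcd i j
bézout i j
  with sign-multiplier i | sign-multiplier j | ℕ.Bézout.identity (ℕ.gcd-GCD ∣ i ∣ ∣ j ∣)
... | σ , eσ | τ , eτ | ℕ.Bézout.+- x y eq =
  + x * σ , - (+ y * τ) , identity⇒combination (+ x) (+ y) i j (pos-identity x y eq) eσ eτ
... | σ , eσ | τ , eτ | ℕ.Bézout.-+ x y eq =
  - (+ x * σ) , + y * τ ,
  trans (ℤ.+-comm (- (+ x * σ) * i) (+ y * τ * j))
        (identity⇒combination (+ y) (+ x) j i (pos-identity y x eq) eτ eσ)

Unimodular : ℤ → ℤ → ℤ → Set
Unimodular a b c = ∃[ α ] ∃[ β ] ∃[ γ ] α * a + β * b + γ * c ≡ 1ℤ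

gcd≡1⇒unimodular : ∀ a b c → gcd (gcd a b) c ≡ 1ℤ → Unimodular a b c
gcd≡1⇒unimodular a b c gcd≡1 with bézout a b | bézout (gcd a b) c
... | α , β , e₁ | δ , γ , e₂ = δ * α , δ * β , γ , (begin
  δ * α * a + δ * β * b + γ * c  ≡⟨ solve (δ ∷ α ∷ β ∷ γ ∷ a ∷ b ∷ c ∷ []) ⟩
  δ * (α * a + β * b) + γ * c    ≡⟨ cong (λ t → δ * t + γ * c) e₁ ⟩
  δ * gcd a b + γ * c            ≡⟨ e₂ ⟩
  gcd (gcd a b) c                ≡⟨ gcd≡1 ⟩
  1ℤ                             ∎)

-- The multiple is y = α t + β q + γ r: as every 2×2 minor of the rows (a b c) and (t q r)
-- vanishes, y v = (α a + β b + γ c) w = w for each column (v , w).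
unimodular-proportional : ∀ {a b c t q r} → Unimodular a b c →
  t * b ≡ a * q × t * c ≡ a * r × q * c ≡ b * r →
  ∃[ y ] y * a ≡ t × y * b ≡ q × y * c ≡ r
unimodular-proportional {a} {b} {c} {t} {q} {r} (α , β , γ , unimodular) (tb≡aq , tc≡ar , qc≡br) =
  α * t + β * q + γ * r ,
  column (ℤ.*-comm t a) (swap-minor t a q b tb≡aq) (swap-minor t a r c tc≡ar) ,
  column tb≡aq (ℤ.*-comm q b) (swap-minor q b r c qc≡br) ,
  column tc≡ar qc≡br (ℤ.*-comm r c)
  where
  swap-minor : ∀ w v w' v' → w * v' ≡ v * w' → w' * v ≡ v' * w
  swap-minor w v w' v' e = trans (ℤ.*-comm w' v) (trans (sym e) (ℤ.*-comm w v'))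

  column : ∀ {v w} → t * v ≡ a * w → q * v ≡ b * w → r * v ≡ c * w → (α * t + β * q + γ * r) * v ≡ w
  column {v} {w} e₁ e₂ e₃ = begin
    (α * t + β * q + γ * r) * v        ≡⟨ solve (α ∷ β ∷ γ ∷ t ∷ q ∷ r ∷ v ∷ []) ⟩
    α * (t * v) + β * (q * v) + γ * (r * v)
      ≡⟨ cong₂ _+_ (cong₂ _+_ (cong (α *_) e₁) (cong (β *_) e₂)) (cong (γ *_) e₃) ⟩
    α * (a * w) + β * (b * w) + γ * (c * w) ≡⟨ solve (α ∷ β ∷ γ ∷ a ∷ b ∷ c ∷ w ∷ []) ⟩
    (α * a + β * b + γ * c) * w        ≡⟨ cong (_* w) unimodular ⟩
    1ℤ * w                             ≡⟨ ℤ.*-identityˡ w ⟩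
    w                                  ∎

-- ℤ[θ] with θ² = a θ + n; the pair (x , y) stands for x + y θ.
module Order (a n : ℤ) where
  infixl 6 _+ₚ_
  infixl 7 _*ₚ_
  infixr 7 _·ₚ_
  infixr 8 _^ₚ_

  _+ₚ_ : ℤ × ℤ → ℤ × ℤ → ℤ × ℤ
  (x , y) +ₚ (x' , y') = x + x' , y + y'

  _*ₚ_ : ℤ × ℤ → ℤ × ℤ → ℤ × ℤ
  (x , y) *ₚ (x' , y') = x * x' + y * y' * n , x * y' + y * x' + y * y' * a

  _·ₚ_ : ℤ → ℤ × ℤ → ℤ × ℤ
  u ·ₚ (x , y) = u * x , u * y

  1ₚ : ℤ × ℤ
  1ₚ = 1ℤ , 0ℤ

  _^ₚ_ : ℤ × ℤ → ℕ → ℤ × ℤ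
  P ^ₚ zero  = 1ₚ
  P ^ₚ suc k = P *ₚ P ^ₚ k

  norm : ℤ × ℤ → ℤ
  norm (x , y) = x * x + x * y * a - y * y * n

  SolvableInOrder : ℤ → ℤ → ℤ → ℕ → ℕ → ℕ → Set
  SolvableInOrder u v w i j k = ∃[ P ] ∃[ Q ] ∃[ R ]
    norm (P *ₚ Q *ₚ R) ≢ 0ℤ × u ·ₚ P ^ₚ i +ₚ v ·ₚ Q ^ₚ j ≡ w ·ₚ R ^ₚ k

  -- A ring homomorphism out of ℤ[θ], given by the operations occurring in u x^i + v y^j = w z^k,
  -- that kills no element of nonzero norm.
  record Realisation : Set₁ where
    infixl 6 _⊹_
    infixl 7 _∙_
    infixr 8 _^_
    field
      Carrier    : Set
      _⊹_ _∙_    : Carrier → Carrier → Carrier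
      0# 1#      : Carrier
      ι          : ℤ → Carrier
      _^_        : Carrier → ℕ → Carrier
      ^-zero     : ∀ t → t ^ zero ≡ 1#
      ^-suc      : ∀ t k → t ^ suc k ≡ t ∙ t ^ k
      h          : ℤ × ℤ → Carrier
      h-+        : ∀ P Q → h (P +ₚ Q) ≡ h P ⊹ h Q
      h-*        : ∀ P Q → h (P *ₚ Q) ≡ h P ∙ h Q
      h-·        : ∀ u P → h (u ·ₚ P) ≡ ι u ∙ h P
      h-1        : h 1ₚ ≡ 1#
      h≡0⇒norm≡0 : ∀ P → h P ≡ 0# → norm P ≡ 0ℤ

    h-^ : ∀ P k → h (P ^ₚ k) ≡ h P ^ k
    h-^ P zero    = trans h-1 (sym (^-zero (h P)))
    h-^ P (suc k) = begin
      h (P *ₚ P ^ₚ k)  ≡⟨ h-* P (P ^ₚ k) ⟩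
      h P ∙ h (P ^ₚ k) ≡⟨ cong (h P ∙_) (h-^ P k) ⟩
      h P ∙ h P ^ k    ≡⟨ ^-suc (h P) k ⟨
      h P ^ suc k      ∎

    h-equation : ∀ u v w i j k P Q R → u ·ₚ P ^ₚ i +ₚ v ·ₚ Q ^ₚ j ≡ w ·ₚ R ^ₚ k →
                 ι u ∙ h P ^ i ⊹ ι v ∙ h Q ^ j ≡ ι w ∙ h R ^ k
    h-equation u v w i j k P Q R e = begin
      ι u ∙ h P ^ i ⊹ ι v ∙ h Q ^ j
        ≡⟨ cong₂ (λ s t → ι u ∙ s ⊹ ι v ∙ t) (h-^ P i) (h-^ Q j) ⟨
      ι u ∙ h (P ^ₚ i) ⊹ ι v ∙ h (Q ^ₚ j)
        ≡⟨ cong₂ _⊹_ (h-· u (P ^ₚ i)) (h-· v (Q ^ₚ j)) ⟨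
      h (u ·ₚ P ^ₚ i) ⊹ h (v ·ₚ Q ^ₚ j)   ≡⟨ h-+ (u ·ₚ P ^ₚ i) (v ·ₚ Q ^ₚ j) ⟨
      h (u ·ₚ P ^ₚ i +ₚ v ·ₚ Q ^ₚ j)      ≡⟨ cong h e ⟩
      h (w ·ₚ R ^ₚ k)                     ≡⟨ h-· w (R ^ₚ k) ⟩
      ι w ∙ h (R ^ₚ k)                    ≡⟨ cong (ι w ∙_) (h-^ R k) ⟩
      ι w ∙ h R ^ k                       ∎

    h-product≢0 : ∀ P Q R → norm (P *ₚ Q *ₚ R) ≢ 0ℤ → h P ∙ h Q ∙ h R ≢ 0#
    h-product≢0 P Q R norm≢0 hPQR≡0 = norm≢0 (h≡0⇒norm≡0 (P *ₚ Q *ₚ R) (begin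
      h (P *ₚ Q *ₚ R)    ≡⟨ h-* (P *ₚ Q) R ⟩
      h (P *ₚ Q) ∙ h R   ≡⟨ cong (_∙ h R) (h-* P Q) ⟩
      h P ∙ h Q ∙ h R    ≡⟨ hPQR≡0 ⟩
      0#                 ∎))

module _ (a b c : ℤ) where
  open Order a (b * c)

  -- x + y θ ↦ x I + y A, a ring embedding since A² = a A + bc I.
  toMat : ℤ × ℤ → M2
  toMat (x , y) = mat (x + y * a) (y * b) (y * c) x

  private
    mat-cong : ∀ {p q r s p' q' r' s'} → p ≡ p' → q ≡ q' → r ≡ r' → s ≡ s' → mat p q r s ≡ mat p' q' r' s'
    mat-cong refl refl refl refl = refl

  toMat-+ : ∀ P Q → toMat (P +ₚ Q) ≡ toMat P ⊕ toMat Q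
  toMat-+ (x , y) (x' , y') = mat-cong e₁₁ (ℤ.*-distribʳ-+ b y y') (ℤ.*-distribʳ-+ c y y') refl
    where
    e₁₁ : x + x' + (y + y') * a ≡ x + y * a + (x' + y' * a)
    e₁₁ = solve (x ∷ y ∷ x' ∷ y' ∷ a ∷ [])

  toMat-· : ∀ u P → toMat (u ·ₚ P) ≡ u · toMat P
  toMat-· u (x , y) = mat-cong e₁₁ (ℤ.*-assoc u y b) (ℤ.*-assoc u y c) refl
    where
    e₁₁ : u * x + u * y * a ≡ u * (x + y * a)
    e₁₁ = solve (u ∷ x ∷ y ∷ a ∷ [])

  toMat-* : ∀ P Q → toMat (P *ₚ Q) ≡ toMat P ⊛ toMat Q
  toMat-* (x , y) (x' , y') = mat-cong e₁₁ e₁₂ e₂₁ e₂₂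
    where
    e₁₁ : x * x' + y * y' * (b * c) + (x * y' + y * x' + y * y' * a) * a ≡ (x + y * a) * (x' + y' * a) + y * b * (y' * c)
    e₁₁ = solve (x ∷ y ∷ x' ∷ y' ∷ a ∷ b ∷ c ∷ [])
    e₁₂ : (x * y' + y * x' + y * y' * a) * b ≡ (x + y * a) * (y' * b) + y * b * x'
    e₁₂ = solve (x ∷ y ∷ x' ∷ y' ∷ a ∷ b ∷ [])
    e₂₁ : (x * y' + y * x' + y * y' * a) * c ≡ y * c * (x' + y' * a) + x * (y' * c)
    e₂₁ = solve (x ∷ y ∷ x' ∷ y' ∷ a ∷ c ∷ [])
    e₂₂ : x * x' + y * y' * (b * c) ≡ y * c * (y' * b) + x * x'
    e₂₂ = solve (x ∷ y ∷ x' ∷ y' ∷ b ∷ c ∷ [])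

  toMat-^ : ∀ P k → toMat (P ^ₚ k) ≡ toMat P ^ᴹ k
  toMat-^ P zero    = refl
  toMat-^ P (suc k) = trans (toMat-* P (P ^ₚ k)) (cong (toMat P ⊛_) (toMat-^ P k))

  toMat-injective : c ≢ 0ℤ → ∀ {P Q} → toMat P ≡ toMat Q → P ≡ Q
  toMat-injective c≢0 {x , y} {x' , y'} e =
    cong₂ _,_ (cong m22 e) (ℤ.*-cancelʳ-≡ y y' c {{ℤ.≢-nonZero c≢0}} (cong m21 e))

  det-toMat : ∀ P → det (toMat P) ≡ norm P
  det-toMat (x , y) = e
    where
    e : (x + y * a) * x - y * b * (y * c) ≡ x * x + x * y * a - y * y * (b * c)
    e = solve (x ∷ y ∷ a ∷ b ∷ c ∷ [])

  commuting⇒minors : ∀ {p q r s} → InC (Amat a b c) (mat p q r s) →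
                     (p - s) * b ≡ a * q × (p - s) * c ≡ a * r × q * c ≡ b * r
  commuting⇒minors {p} {q} {r} {s} AX≡XA = e₁₂ , e₂₁ , e₂₂
    where
    e₁₂ : (p - s) * b ≡ a * q
    e₁₂ = begin
      (p - s) * b                ≡⟨ solve (p ∷ q ∷ s ∷ b ∷ []) ⟩
      p * b + q * 0ℤ - b * s     ≡⟨ cong (_- b * s) (cong m12 AX≡XA) ⟨
      a * q + b * s - b * s      ≡⟨ solve (a ∷ q ∷ b ∷ s ∷ []) ⟩
      a * q                      ∎
    e₂₁ : (p - s) * c ≡ a * r
    e₂₁ = begin
      (p - s) * c                ≡⟨ solve (p ∷ r ∷ s ∷ c ∷ []) ⟩
      c * p + 0ℤ * r - s * c     ≡⟨ cong (_- s * c) (cong m21 AX≡XA) ⟩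
      r * a + s * c - s * c      ≡⟨ solve (r ∷ a ∷ s ∷ c ∷ []) ⟩
      a * r                      ∎
    e₂₂ : q * c ≡ b * r
    e₂₂ = begin
      q * c                      ≡⟨ solve (q ∷ s ∷ c ∷ []) ⟩
      c * q + 0ℤ * s             ≡⟨ cong m22 AX≡XA ⟩
      r * b + s * 0ℤ             ≡⟨ solve (r ∷ s ∷ b ∷ []) ⟩
      b * r                      ∎

  centraliser⊆image : gcd (gcd a b) c ≡ 1ℤ → ∀ X → InC (Amat a b c) X → ∃[ P ] X ≡ toMat P
  centraliser⊆image gcd≡1 (mat p q r s) AX≡XA =
    image (unimodular-proportional (gcd≡1⇒unimodular a b c gcd≡1) (commuting⇒minors AX≡XA))
    where
    image : ∃[ y ] y * a ≡ p - s × y * b ≡ q × y * c ≡ r → ∃[ P ] mat p q r s ≡ toMat P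
    image (y , ya≡p-s , yb≡q , yc≡r) = (s , y) , mat-cong p≡s+ya (sym yb≡q) (sym yc≡r) refl
      where
      p≡s+ya : p ≡ s + y * a
      p≡s+ya = begin
        p            ≡⟨ solve (p ∷ s ∷ []) ⟩
        s + (p - s)  ≡⟨ cong (λ t → s + t) ya≡p-s ⟨
        s + y * a    ∎

  toMat-equation : c ≢ 0ℤ → ∀ u v w i j k P Q R →
    u · toMat P ^ᴹ i ⊕ v · toMat Q ^ᴹ j ≡ w · toMat R ^ᴹ k →
    u ·ₚ P ^ₚ i +ₚ v ·ₚ Q ^ₚ j ≡ w ·ₚ R ^ₚ k
  toMat-equation c≢0 u v w i j k P Q R e = toMat-injective c≢0 (begin
    toMat (u ·ₚ P ^ₚ i +ₚ v ·ₚ Q ^ₚ j)      ≡⟨ toMat-+ (u ·ₚ P ^ₚ i) (v ·ₚ Q ^ₚ j) ⟩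
    toMat (u ·ₚ P ^ₚ i) ⊕ toMat (v ·ₚ Q ^ₚ j) ≡⟨ cong₂ _⊕_ (toMat-· u (P ^ₚ i)) (toMat-· v (Q ^ₚ j)) ⟩
    u · toMat (P ^ₚ i) ⊕ v · toMat (Q ^ₚ j) ≡⟨ cong₂ (λ S T → u · S ⊕ v · T) (toMat-^ P i) (toMat-^ Q j) ⟩
    u · toMat P ^ᴹ i ⊕ v · toMat Q ^ᴹ j     ≡⟨ e ⟩
    w · toMat R ^ᴹ k                        ≡⟨ cong (w ·_) (toMat-^ R k) ⟨
    w · toMat (R ^ₚ k)                      ≡⟨ toMat-· w (R ^ₚ k) ⟨
    toMat (w ·ₚ R ^ₚ k)                     ∎)

  det-toMat-product : ∀ P Q R → det (toMat P ⊛ toMat Q ⊛ toMat R) ≡ norm (P *ₚ Q *ₚ R)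
  det-toMat-product P Q R = begin
    det (toMat P ⊛ toMat Q ⊛ toMat R)  ≡⟨ cong (λ S → det (S ⊛ toMat R)) (toMat-* P Q) ⟨
    det (toMat (P *ₚ Q) ⊛ toMat R)     ≡⟨ cong det (toMat-* (P *ₚ Q) R) ⟨
    det (toMat (P *ₚ Q *ₚ R))          ≡⟨ det-toMat (P *ₚ Q *ₚ R) ⟩
    norm (P *ₚ Q *ₚ R)                 ∎

  SolvableInC : ℤ → ℤ → ℤ → ℕ → ℕ → ℕ → Set
  SolvableInC u v w i j k = Σ M2 λ X → Σ M2 λ Y → Σ M2 λ Z →
    InC (Amat a b c) X × InC (Amat a b c) Y × InC (Amat a b c) Z ×
    det (X ⊛ Y ⊛ Z) ≢ 0ℤ × u · X ^ᴹ i ⊕ v · Y ^ᴹ j ≡ w · Z ^ᴹ k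

  SolvableInC⇒SolvableInOrder : c ≢ 0ℤ → gcd (gcd a b) c ≡ 1ℤ → ∀ u v w i j k →
    SolvableInC u v w i j k → SolvableInOrder u v w i j k
  SolvableInC⇒SolvableInOrder c≢0 gcd≡1 u v w i j k (X , Y , Z , X∈C , Y∈C , Z∈C , det≢0 , e) =
    pull-back (centraliser⊆image gcd≡1 X X∈C) (centraliser⊆image gcd≡1 Y Y∈C)
              (centraliser⊆image gcd≡1 Z Z∈C) det≢0 e
    where
    pull-back : ∀ {X′ Y′ Z′} → ∃[ P ] X′ ≡ toMat P → ∃[ Q ] Y′ ≡ toMat Q → ∃[ R ] Z′ ≡ toMat R →
      det (X′ ⊛ Y′ ⊛ Z′) ≢ 0ℤ → u · X′ ^ᴹ i ⊕ v · Y′ ^ᴹ j ≡ w · Z′ ^ᴹ k → SolvableInOrder u v w i j k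
    pull-back (P , refl) (Q , refl) (R , refl) det≢0 e =
      P , Q , R , (λ norm≡0 → det≢0 (trans (det-toMat-product P Q R) norm≡0)) ,
      toMat-equation c≢0 u v w i j k P Q R e

odd≢even : ∀ x y → 1ℤ + + 2 * x ≢ + 2 * y
odd≢even x y e = contradiction (ℕ.∣1⇒≡1 (ℤ.∣⇒∣ᵤ (ℤ.divides (y - x) 1≡[y-x]*2))) λ ()
  where
  1≡[y-x]*2 : 1ℤ ≡ (y - x) * + 2
  1≡[y-x]*2 = begin
    1ℤ                     ≡⟨ solve (x ∷ []) ⟩
    1ℤ + + 2 * x - + 2 * x ≡⟨ cong (_- + 2 * x) e ⟩
    + 2 * y - + 2 * x      ≡⟨ solve (x ∷ y ∷ []) ⟩
    (y - x) * + 2          ∎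

even-or-odd : ∀ z → ∃[ k ] (z ≡ + 2 * k ⊎ z ≡ 1ℤ + + 2 * k)
even-or-odd z with z ℤ./ + 2 | z ℤ.% + 2 | ℤ.n%d<d z (+ 2) | ℤ.a≡a%n+[a/n]*n z (+ 2)
... | k | 0 | _ | z≡ = k , inj₁ (trans z≡ (trans (ℤ.+-identityˡ (k * + 2)) (ℤ.*-comm k (+ 2))))
... | k | 1 | _ | z≡ = k , inj₂ (trans z≡ (cong (λ t → 1ℤ + t) (ℤ.*-comm k (+ 2))))
... | k | suc (suc _) | s≤s (s≤s ()) | _

-- With d = m - a, the equation m² = a² + 4n reads 4n = d (d + 2a); so d is even, d = 2k,
-- and l = a + k is a root.
square-discriminant⇒root : ∀ a n → IsSquare (a * a + + 4 * n) → ∃[ l ] l * l ≡ a * l + n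
square-discriminant⇒root a n (m , m²≡D) = root (even-or-odd (m - a))
  where
  4n≡d[d+2a] : + 4 * n ≡ (m - a) * ((m - a) + + 2 * a)
  4n≡d[d+2a] = begin
    + 4 * n                  ≡⟨ solve (a ∷ n ∷ []) ⟩
    a * a + + 4 * n - a * a  ≡⟨ cong (_- a * a) m²≡D ⟨
    m * m - a * a            ≡⟨ solve (m ∷ a ∷ []) ⟩
    (m - a) * ((m - a) + + 2 * a) ∎

  even-root : ∀ {d} k → d ≡ + 2 * k → + 4 * n ≡ d * (d + + 2 * a) →
              (a + k) * (a + k) ≡ a * (a + k) + n
  even-root k refl 4n≡d[d+2a] = begin
    (a + k) * (a + k)          ≡⟨ solve (a ∷ k ∷ []) ⟩
    a * (a + k) + k * (k + a)  ≡⟨ cong (λ t → a * (a + k) + t) n≡k[k+a] ⟨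
    a * (a + k) + n            ∎
    where
    n≡k[k+a] : n ≡ k * (k + a)
    n≡k[k+a] = ℤ.*-cancelˡ-≡ (+ 4) n (k * (k + a)) (begin
      + 4 * n                                ≡⟨ 4n≡d[d+2a] ⟩
      + 2 * k * (+ 2 * k + + 2 * a)          ≡⟨ solve (k ∷ a ∷ []) ⟩
      + 4 * (k * (k + a))                    ∎)

  odd-root : ∀ {d} k → d ≡ 1ℤ + + 2 * k → + 4 * n ≢ d * (d + + 2 * a)
  odd-root k refl 4n≡d[d+2a] = odd≢even (k + k + a + + 2 * (k * k + a * k)) (+ 2 * n) (begin
    1ℤ + + 2 * (k + k + a + + 2 * (k * k + a * k)) ≡⟨ solve (k ∷ a ∷ []) ⟩
    (1ℤ + + 2 * k) * (1ℤ + + 2 * k + + 2 * a)      ≡⟨ 4n≡d[d+2a] ⟨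
    + 4 * n                                        ≡⟨ solve (n ∷ []) ⟩
    + 2 * (+ 2 * n)                                ∎)

  root : ∃[ k ] (m - a ≡ + 2 * k ⊎ m - a ≡ 1ℤ + + 2 * k) → ∃[ l ] l * l ≡ a * l + n
  root (k , inj₁ d≡2k)   = a + k , even-root k d≡2k 4n≡d[d+2a]
  root (k , inj₂ d≡1+2k) = ⊥-elim (odd-root k d≡1+2k 4n≡d[d+2a])

module _ (a n : ℤ) where
  open Order a n

  integer-realisation : ∀ l → l * l ≡ a * l + n → Realisation
  integer-realisation l l²≡al+n = record
    { Carrier = ℤ ; _⊹_ = _+_ ; _∙_ = _*_ ; 0# = 0ℤ ; 1# = 1ℤ ; ι = λ u → u
    ; _^_ = ℤ._^_ ; ^-zero = λ _ → refl ; ^-suc = λ _ _ → refl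
    ; h = evaluate ; h-+ = λ (x , y) (x' , y') → evaluate-+ x y x' y'
    ; h-* = evaluate-* ; h-· = λ u (x , y) → evaluate-· u x y ; h-1 = refl
    ; h≡0⇒norm≡0 = evaluate≡0⇒norm≡0
    }
    where
    evaluate : ℤ × ℤ → ℤ
    evaluate (x , y) = x + y * l

    evaluate-+ : ∀ x y x' y' → x + x' + (y + y') * l ≡ x + y * l + (x' + y' * l)
    evaluate-+ x y x' y' = solve (x ∷ y ∷ x' ∷ y' ∷ l ∷ [])

    evaluate-· : ∀ u x y → u * x + u * y * l ≡ u * (x + y * l)
    evaluate-· u x y = solve (u ∷ x ∷ y ∷ l ∷ [])

    evaluate-* : ∀ P Q → evaluate (P *ₚ Q) ≡ evaluate P * evaluate Q
    evaluate-* (x , y) (x' , y') = begin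
      x * x' + y * y' * n + (x * y' + y * x' + y * y' * a) * l
        ≡⟨ solve (x ∷ y ∷ x' ∷ y' ∷ a ∷ n ∷ l ∷ []) ⟩
      x * x' + (x * y' + y * x') * l + y * y' * (a * l + n)
        ≡⟨ cong (λ t → x * x' + (x * y' + y * x') * l + y * y' * t) l²≡al+n ⟨
      x * x' + (x * y' + y * x') * l + y * y' * (l * l)
        ≡⟨ solve (x ∷ y ∷ x' ∷ y' ∷ l ∷ []) ⟩
      (x + y * l) * (x' + y' * l) ∎

    evaluate≡0⇒norm≡0 : ∀ P → evaluate P ≡ 0ℤ → norm P ≡ 0ℤ
    evaluate≡0⇒norm≡0 (x , y) x+yl≡0 = begin
      x * x + x * y * a - y * y * n
        ≡⟨ solve (x ∷ y ∷ a ∷ n ∷ l ∷ []) ⟩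
      (x + y * l) * (x + y * a - y * l) + y * y * (l * l - (a * l + n))
        ≡⟨ cong₂ (λ s t → s * (x + y * a - y * l) + y * y * (t - (a * l + n))) x+yl≡0 l²≡al+n ⟩
      0ℤ * (x + y * a - y * l) + y * y * ((a * l + n) - (a * l + n))
        ≡⟨ solve (x ∷ y ∷ a ∷ n ∷ l ∷ []) ⟩
      0ℤ ∎

ℚ-ring : AlmostCommutativeRing 0ℓ 0ℓ
ℚ-ring = fromCommutativeRing ℚ.+-*-commutativeRing (λ p → dec⇒maybe (0ℚ ℚ.≟ p))

toℚ : ℤ → ℚ
toℚ m = m ℚ./ 1

toℚ≡mkℚ : ∀ m → toℚ m ≡ mkℚ m 0 (Coprimality.sym (Coprimality.1-coprimeTo ∣ m ∣))
toℚ≡mkℚ m = ℚ.fromℚᵘ-toℚᵘ (mkℚ m 0 _)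

toℚ-+ : ∀ m n → toℚ (m + n) ≡ toℚ m ℚ.+ toℚ n
toℚ-+ m n = sym (begin
  toℚ m ℚ.+ toℚ n            ≡⟨ cong₂ ℚ._+_ (toℚ≡mkℚ m) (toℚ≡mkℚ n) ⟩
  (m * 1ℤ + n * 1ℤ) ℚ./ 1    ≡⟨ cong (ℚ._/ 1) (cong₂ _+_ (ℤ.*-identityʳ m) (ℤ.*-identityʳ n)) ⟩
  toℚ (m + n)                ∎)

toℚ-* : ∀ m n → toℚ (m * n) ≡ toℚ m ℚ.* toℚ n
toℚ-* m n = sym (cong₂ ℚ._*_ (toℚ≡mkℚ m) (toℚ≡mkℚ n))

toℚ-neg : ∀ m → toℚ (- m) ≡ ℚ.- toℚ m
toℚ-neg (+ zero)  = refl
toℚ-neg +[1+ k ]  = trans (toℚ≡mkℚ -[1+ k ]) (cong ℚ.-_ (sym (toℚ≡mkℚ +[1+ k ])))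
toℚ-neg -[1+ k ]  = trans (toℚ≡mkℚ +[1+ k ]) (cong ℚ.-_ (sym (toℚ≡mkℚ -[1+ k ])))

toℚ-injective : ∀ {m n} → toℚ m ≡ toℚ n → m ≡ n
toℚ-injective {m} {n} e = begin
  m            ≡⟨ cong ℚ.↥_ (toℚ≡mkℚ m) ⟨
  ℚ.↥ toℚ m    ≡⟨ cong ℚ.↥_ e ⟩
  ℚ.↥ toℚ n    ≡⟨ cong ℚ.↥_ (toℚ≡mkℚ n) ⟩
  n            ∎

private
  four : ℚ
  four = toℚ (+ 4)

  θ-+-re : ∀ X Y X' Y' A →
    X ℚ.+ X' ℚ.+ (Y ℚ.+ Y') ℚ.* A ℚ.* ½ ≡ X ℚ.+ Y ℚ.* A ℚ.* ½ ℚ.+ (X' ℚ.+ Y' ℚ.* A ℚ.* ½)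
  θ-+-re X Y X' Y' A = RingSolver.solve (X ∷ Y ∷ X' ∷ Y' ∷ A ∷ []) ℚ-ring

  θ-·-re : ∀ U X Y A d →
    U ℚ.* X ℚ.+ U ℚ.* Y ℚ.* A ℚ.* ½ ≡ U ℚ.* (X ℚ.+ Y ℚ.* A ℚ.* ½) ℚ.+ d ℚ.* (0ℚ ℚ.* (Y ℚ.* ½))
  θ-·-re U X Y A d = RingSolver.solve (U ∷ X ∷ Y ∷ A ∷ d ∷ []) ℚ-ring

  θ-·-im : ∀ U X Y A → U ℚ.* Y ℚ.* ½ ≡ U ℚ.* (Y ℚ.* ½) ℚ.+ 0ℚ ℚ.* (X ℚ.+ Y ℚ.* A ℚ.* ½)
  θ-·-im U X Y A = RingSolver.solve (U ∷ X ∷ Y ∷ A ∷ []) ℚ-ring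

  θ-*-re : ∀ X Y X' Y' A N {d} → d ≡ A ℚ.* A ℚ.+ four ℚ.* N →
    X ℚ.* X' ℚ.+ Y ℚ.* Y' ℚ.* N ℚ.+ (X ℚ.* Y' ℚ.+ Y ℚ.* X' ℚ.+ Y ℚ.* Y' ℚ.* A) ℚ.* A ℚ.* ½
    ≡ (X ℚ.+ Y ℚ.* A ℚ.* ½) ℚ.* (X' ℚ.+ Y' ℚ.* A ℚ.* ½) ℚ.+ d ℚ.* (Y ℚ.* ½ ℚ.* (Y' ℚ.* ½))
  θ-*-re X Y X' Y' A N refl = RingSolver.solve (X ∷ Y ∷ X' ∷ Y' ∷ A ∷ N ∷ []) ℚ-ring

  θ-*-im : ∀ X Y X' Y' A →
    (X ℚ.* Y' ℚ.+ Y ℚ.* X' ℚ.+ Y ℚ.* Y' ℚ.* A) ℚ.* ½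
    ≡ (X ℚ.+ Y ℚ.* A ℚ.* ½) ℚ.* (Y' ℚ.* ½) ℚ.+ Y ℚ.* ½ ℚ.* (X' ℚ.+ Y' ℚ.* A ℚ.* ½)
  θ-*-im X Y X' Y' A = RingSolver.solve (X ∷ Y ∷ X' ∷ Y' ∷ A ∷ []) ℚ-ring

  θ-1-re : ∀ A → 1ℚ ℚ.+ 0ℚ ℚ.* A ℚ.* ½ ≡ 1ℚ
  θ-1-re A = RingSolver.solve (A ∷ []) ℚ-ring

  θ-norm : ∀ X Y A N {d} → d ≡ A ℚ.* A ℚ.+ four ℚ.* N →
    X ℚ.* X ℚ.+ X ℚ.* Y ℚ.* A ℚ.- Y ℚ.* Y ℚ.* N
    ≡ (X ℚ.+ Y ℚ.* A ℚ.* ½) ℚ.* (X ℚ.+ Y ℚ.* A ℚ.* ½) ℚ.- d ℚ.* (Y ℚ.* ½ ℚ.* (Y ℚ.* ½))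
  θ-norm X Y A N refl = RingSolver.solve (X ∷ Y ∷ A ∷ N ∷ []) ℚ-ring

  θ-trace : ∀ X Y A → X ℚ.+ X ℚ.+ Y ℚ.* A ≡ X ℚ.+ Y ℚ.* A ℚ.* ½ ℚ.+ (X ℚ.+ Y ℚ.* A ℚ.* ½)
  θ-trace X Y A = RingSolver.solve (X ∷ Y ∷ A ∷ []) ℚ-ring

  -- The two components of evalMonic (m ∷ t ∷ []) (r +√· s), i.e. of m + t z + z² for z = r + s √d.
  quadratic-re : ∀ r s d {M T} → M ≡ r ℚ.* r ℚ.- d ℚ.* (s ℚ.* s) → T ≡ ℚ.- (r ℚ.+ r) →
    M ℚ.+ (r ℚ.* (T ℚ.+ (r ℚ.* 1ℚ ℚ.+ d ℚ.* (s ℚ.* 0ℚ))) ℚ.+ d ℚ.* (s ℚ.* (0ℚ ℚ.+ (r ℚ.* 0ℚ ℚ.+ s ℚ.* 1ℚ)))) ≡ 0ℚ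
  quadratic-re r s d refl refl = RingSolver.solve (r ∷ s ∷ d ∷ []) ℚ-ring

  quadratic-im : ∀ r s d {T} → T ≡ ℚ.- (r ℚ.+ r) →
    0ℚ ℚ.+ (r ℚ.* (0ℚ ℚ.+ (r ℚ.* 0ℚ ℚ.+ s ℚ.* 1ℚ)) ℚ.+ s ℚ.* (T ℚ.+ (r ℚ.* 1ℚ ℚ.+ d ℚ.* (s ℚ.* 0ℚ)))) ≡ 0ℚ
  quadratic-im r s d refl = RingSolver.solve (r ∷ s ∷ d ∷ []) ℚ-ring

-- z is a root of t² - T t + M, where T and M are its trace and norm.
trace-norm-integral : ∀ {D} (z : K D) T M → toℚ T ≡ re z ℚ.+ re z →
  toℚ M ≡ re z ℚ.* re z ℚ.- Dℚ {D} ℚ.* (im z ℚ.* im z) → InOK z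
trace-norm-integral {D} (r +√· s) T M T≡ M≡ =
  (M ∷ - T ∷ []) , cong₂ _+√·_ (quadratic-re r s (Dℚ {D}) M≡ -T≡) (quadratic-im r s (Dℚ {D}) -T≡)
  where
  -T≡ : toℚ (- T) ≡ ℚ.- (r ℚ.+ r)
  -T≡ = trans (toℚ-neg T) (cong ℚ.-_ T≡)

module Field (a n : ℤ) where
  open Order a n

  D : ℤ
  D = a * a + + 4 * n

  A N : ℚ
  A = toℚ a
  N = toℚ n

  toℚ-D : Dℚ {D} ≡ A ℚ.* A ℚ.+ four ℚ.* N
  toℚ-D = trans (toℚ-+ (a * a) (+ 4 * n)) (cong₂ ℚ._+_ (toℚ-* a a) (toℚ-* (+ 4) n))

  -- x + y θ with θ = (a + √D) / 2, the root of t² - a t - n in K.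
  embed : ℤ × ℤ → K D
  embed (x , y) = (toℚ x ℚ.+ toℚ y ℚ.* A ℚ.* ½) +√· (toℚ y ℚ.* ½)

  private
    re-cong : ∀ {X Y X' Y'} → X ≡ X' → Y ≡ Y' → X ℚ.+ Y ℚ.* A ℚ.* ½ ≡ X' ℚ.+ Y' ℚ.* A ℚ.* ½
    re-cong = cong₂ (λ s t → s ℚ.+ t ℚ.* A ℚ.* ½)

  embed-+ : ∀ P Q → embed (P +ₚ Q) ≡ embed P +ᴷ embed Q
  embed-+ (x , y) (x' , y') = cong₂ _+√·_
    (trans (re-cong (toℚ-+ x x') (toℚ-+ y y')) (θ-+-re (toℚ x) (toℚ y) (toℚ x') (toℚ y') A))
    (trans (cong (ℚ._* ½) (toℚ-+ y y')) (ℚ.*-distribʳ-+ ½ (toℚ y) (toℚ y')))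

  embed-· : ∀ u P → embed (u ·ₚ P) ≡ ιᴷ u *ᴷ embed P
  embed-· u (x , y) = cong₂ _+√·_
    (trans (re-cong (toℚ-* u x) (toℚ-* u y)) (θ-·-re (toℚ u) (toℚ x) (toℚ y) A (Dℚ {D})))
    (trans (cong (ℚ._* ½) (toℚ-* u y)) (θ-·-im (toℚ u) (toℚ x) (toℚ y) A))

  embed-* : ∀ P Q → embed (P *ₚ Q) ≡ embed P *ᴷ embed Q
  embed-* (x , y) (x' , y') = cong₂ _+√·_
    (trans (re-cong toℚ-re toℚ-im) (θ-*-re X Y X' Y' A N toℚ-D))
    (trans (cong (ℚ._* ½) toℚ-im) (θ-*-im X Y X' Y' A))
    where
    X = toℚ x ; Y = toℚ y ; X' = toℚ x' ; Y' = toℚ y'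
    toℚ-re : toℚ (x * x' + y * y' * n) ≡ X ℚ.* X' ℚ.+ Y ℚ.* Y' ℚ.* N
    toℚ-re = trans (toℚ-+ (x * x') (y * y' * n))
      (cong₂ ℚ._+_ (toℚ-* x x') (trans (toℚ-* (y * y') n) (cong (ℚ._* N) (toℚ-* y y'))))
    toℚ-im : toℚ (x * y' + y * x' + y * y' * a) ≡ X ℚ.* Y' ℚ.+ Y ℚ.* X' ℚ.+ Y ℚ.* Y' ℚ.* A
    toℚ-im = trans (toℚ-+ (x * y' + y * x') (y * y' * a))
      (cong₂ ℚ._+_ (trans (toℚ-+ (x * y') (y * x')) (cong₂ ℚ._+_ (toℚ-* x y') (toℚ-* y x')))
                   (trans (toℚ-* (y * y') a) (cong (ℚ._* A) (toℚ-* y y'))))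

  toℚ-norm : ∀ P → toℚ (norm P) ≡ re (embed P) ℚ.* re (embed P) ℚ.- Dℚ {D} ℚ.* (im (embed P) ℚ.* im (embed P))
  toℚ-norm (x , y) = trans toℚ-norm′ (θ-norm X Y A N toℚ-D)
    where
    X = toℚ x ; Y = toℚ y
    toℚ-norm′ : toℚ (x * x + x * y * a - y * y * n) ≡ X ℚ.* X ℚ.+ X ℚ.* Y ℚ.* A ℚ.- Y ℚ.* Y ℚ.* N
    toℚ-norm′ = trans (toℚ-+ (x * x + x * y * a) (- (y * y * n)))
      (cong₂ ℚ._+_ (trans (toℚ-+ (x * x) (x * y * a)) (cong₂ ℚ._+_ (toℚ-* x x) (trans (toℚ-* (x * y) a) (cong (ℚ._* A) (toℚ-* x y)))))
                   (trans (toℚ-neg (y * y * n)) (cong ℚ.-_ (trans (toℚ-* (y * y) n) (cong (ℚ._* N) (toℚ-* y y))))))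

  trace : ℤ × ℤ → ℤ
  trace (x , y) = x + x + y * a

  toℚ-trace : ∀ P → toℚ (trace P) ≡ re (embed P) ℚ.+ re (embed P)
  toℚ-trace (x , y) = trans
    (trans (toℚ-+ (x + x) (y * a)) (cong₂ ℚ._+_ (toℚ-+ x x) (toℚ-* y a)))
    (θ-trace (toℚ x) (toℚ y) A)

  embed-integral : ∀ P → InOK (embed P)
  embed-integral P = trace-norm-integral (embed P) (trace P) (norm P) (toℚ-trace P) (toℚ-norm P)

  embed≡0⇒norm≡0 : ∀ P → embed P ≡ 0ᴷ → norm P ≡ 0ℤ
  embed≡0⇒norm≡0 P e = toℚ-injective (begin
    toℚ (norm P)  ≡⟨ toℚ-norm P ⟩
    re (embed P) ℚ.* re (embed P) ℚ.- Dℚ {D} ℚ.* (im (embed P) ℚ.* im (embed P))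
      ≡⟨ cong₂ (λ r s → r ℚ.* r ℚ.- Dℚ {D} ℚ.* (s ℚ.* s)) (cong re e) (cong im e) ⟩
    0ℚ ℚ.* 0ℚ ℚ.- Dℚ {D} ℚ.* (0ℚ ℚ.* 0ℚ) ≡⟨ cong (ℚ._-_ 0ℚ) (ℚ.*-zeroʳ (Dℚ {D})) ⟩
    0ℚ            ∎)

  field-realisation : Realisation
  field-realisation = record
    { Carrier = K D ; _⊹_ = _+ᴷ_ ; _∙_ = _*ᴷ_ ; 0# = 0ᴷ ; 1# = 1ᴷ ; ι = ιᴷ
    ; _^_ = _^ᴷ_ ; ^-zero = λ _ → refl ; ^-suc = λ _ _ → refl
    ; h = embed ; h-+ = embed-+ ; h-* = embed-* ; h-· = embed-· ; h-1 = cong₂ _+√·_ (θ-1-re A) refl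
    ; h≡0⇒norm≡0 = embed≡0⇒norm≡0
    }

-- A square root of D has absolute value at most ∣ D ∣, so a bounded search decides squareness.
isSquare? : ∀ D → Dec (IsSquare D)
isSquare? D = map′ (λ (n , _ , e) → + n , e) (λ (m , e) → ∣ m ∣ , s≤s (bound m e) , trans (+∣m∣*+∣m∣≡m*m m) e)
  (ℕ.anyUpTo? (λ n → + n * + n ℤ.≟ D) (suc ∣ D ∣))
  where
  bound : ∀ m → m * m ≡ D → ∣ m ∣ ≤ ∣ D ∣
  bound m e = subst (∣ m ∣ ≤_) (trans (sym (ℤ.abs-* m m)) (cong ∣_∣ e)) (n≤n*n ∣ m ∣)
    where
    n≤n*n : ∀ n → n ℕ.≤ n ℕ.* n
    n≤n*n zero    = z≤n
    n≤n*n (suc n) = ℕ.m≤m*n (suc n) (suc n)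

  +∣m∣*+∣m∣≡m*m : ∀ m → + ∣ m ∣ * + ∣ m ∣ ≡ m * m
  +∣m∣*+∣m∣≡m*m (+ n)    = refl
  +∣m∣*+∣m∣≡m*m -[1+ n ] = refl

module _ (a b c : ℤ) where
  open Order a (b * c)

  SolvableInOrder⇒SolvableInOK : ∀ u v w i j k →
    SolvableInOrder u v w i j k → SolvableInOK (disc a b c) u v w i j k
  SolvableInOrder⇒SolvableInOK u v w i j k (P , Q , R , norm≢0 , e) with isSquare? (disc a b c)
  ... | yes square = inj₁ (square , solution (square-discriminant⇒root a (b * c) square))
    where
    solution : ∃[ l ] l * l ≡ a * l + b * c → SolvableInℤ u v w i j k
    solution (l , root) = h P , h Q , h R , h-product≢0 P Q R norm≢0 , h-equation u v w i j k P Q R e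
      where open Realisation (integer-realisation a (b * c) l root)
  ... | no ¬square = inj₂ (¬square ,
    h P , h Q , h R , embed-integral P , embed-integral Q , embed-integral R ,
    h-product≢0 P Q R norm≢0 , h-equation u v w i j k P Q R e)
    where
    open Field a (b * c)
    open Realisation field-realisation

lemma3p2 : (a b c : ℤ) → b * c ≢ 0ℤ → gcd (gcd a b) c ≡ 1ℤ →
    (u v w : ℤ) → u ≢ 0ℤ → v ≢ 0ℤ → w ≢ 0ℤ → gcd (gcd u v) w ≡ 1ℤ →
    (i j k : ℕ) → 1 ≤ i → 1 ≤ j → 1 ≤ k →
    Σ M2 (λ X → Σ M2 (λ Y → Σ M2 (λ Z →
      InC (Amat a b c) X × InC (Amat a b c) Y × InC (Amat a b c) Z ×
      det (X ⊛ Y ⊛ Z) ≢ 0ℤ ×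
      ((u · (X ^ᴹ i)) ⊕ (v · (Y ^ᴹ j)) ≡ w · (Z ^ᴹ k))))) →
    SolvableInOK (disc a b c) u v w i j k
lemma3p2 a b c bc≢0 gcd≡1 u v w _ _ _ _ i j k _ _ _ solution =
  SolvableInOrder⇒SolvableInOK a b c u v w i j k
    (SolvableInC⇒SolvableInOrder a b c c≢0 gcd≡1 u v w i j k solution)
  where
  c≢0 : c ≢ 0ℤ
  c≢0 refl = bc≢0 (ℤ.*-zeroʳ b)
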